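{- Let $\mathbf{S}\in\mathbb{Q}[[s_2,s_3,\dots]]$ be the unique formal power series with constant term $1$ satisfying $$0=1-\mathbf{S}+\sum_{k\ge2} s_k\,\mathbf{S}^{k},$$ let $\mathbf{S}_1=s_2+s_3+s_4+\cdots$, and let $\mathbf{G}\in\mathbb{Q}[[s_2,s_3,\dots]]$ be the formal power series with $\mathbf{S}-1=\mathbf{S}_1\,\mathbf{G}$. Fix an integer $a\ge2$. For non-negative integers $m_a,m_{a+1}$, let $\widetilde{G}[m_a,m_{a+1}]$ denote the coefficient of $s_a^{m_a}s_{a+1}^{m_{a+1}}$ (all other variables having exponent $0$) in $\mathbf{G}$, and put $m=m_a+m_{a+1}$. Then $$\widetilde{G}[m_a,m_{a+1}]=\frac{\bigl(am_a+(a+1)(m_{a+1}+1)\bigr)!}{\bigl(a(m+1)+1\bigr)(m+1)\,\bigl((a-1)m_a+a(m_{a+1}+1)\bigr)!\,m_a!\,m_{a+1}!}.$$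
   Context: $\mathbf{S}$ is the series solution $\alpha$ of the general polynomial equation $0=1-\alpha+\sum_{k\ge2}s_k\alpha^k$; here the variable $s_k$ multiplies $\alpha^k$. It is known that $\mathbf{S}-1$ is divisible by $\mathbf{S}_1$ in the ring of formal power series, so the quotient $\mathbf{G}$ (the "Geode series") is a well-defined formal power series. -}

module Defs where

open import Data.Nat as ℕ using (ℕ; zero; suc; _∸_; _!)
open import Data.Nat.Properties using (_!≢0; m*n≢0)
open import Data.Integer using (+_)
open import Data.Bool using (Bool; true; false; _∧_; if_then_else_)
open import Data.List using (List; []; _∷_; [_]; map; concatMap; upTo; zipWith; foldr; length; replicate; _++_)
open import Data.Maybe using (Maybe; just; nothing; maybe)
open import Data.Rational using (ℚ; 0ℚ; 1ℚ; _+_; _*_; _/_)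

-- A monomial in the variables s₂, s₃, s₄, … is a list of exponents:
-- entry i of the list is the exponent of s_(i+2); missing entries are 0.
Mono : Set
Mono = List ℕ

Series : Set
Series = Mono → ℚ

subs : Mono → List Mono
subs []      = [ [] ]
subs (e ∷ μ) = concatMap (λ d → map (d ∷_) (subs μ)) (upTo (suc e))

sumℚ : List ℚ → ℚ
sumℚ = foldr _+_ 0ℚ

_⊛_ : Series → Series → Series
(f ⊛ g) μ = sumℚ (map (λ ν → f ν * g (zipWith _∸_ μ ν)) (subs μ))

allZero : Mono → Bool
allZero []          = true
allZero (zero ∷ μ)  = allZero μ
allZero (suc _ ∷ μ) = false

oneS : Series
oneS μ = if allZero μ then 1ℚ else 0ℚ

_^S_ : Series → ℕ → Series
f ^S zero  = oneS
f ^S suc k = f ⊛ (f ^S k)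

decAt : ℕ → Mono → Maybe Mono
decAt zero    []          = nothing
decAt zero    (zero ∷ μ)  = nothing
decAt zero    (suc e ∷ μ) = just (e ∷ μ)
decAt (suc i) []          = nothing
decAt (suc i) (e ∷ μ)     = Data.Maybe.map (e ∷_) (decAt i μ)

varMul : ℕ → Series → Series
varMul i T μ = maybe T 0ℚ (decAt i μ)

-- the series  Σ_{k ≥ 2} s_k S^k   (k = i + 2; only variables occurring in
-- the monomial can contribute, so the sum is finite coefficientwise)
sumTerm : Series → Series
sumTerm S μ = sumℚ (map (λ i → varMul i (S ^S (i ℕ.+ 2)) μ) (upTo (length μ)))

isUnit : Mono → Bool
isUnit []                = false
isUnit (zero ∷ μ)        = isUnit μ
isUnit (suc zero ∷ μ)    = allZero μ
isUnit (suc (suc _) ∷ μ) = false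

S₁ : Series
S₁ μ = if isUnit μ then 1ℚ else 0ℚ

coeffMono : ℕ → ℕ → ℕ → Mono
coeffMono a ma mb = replicate (a ∸ 2) 0 ++ (ma ∷ mb ∷ [])

geodeFormula : ℕ → ℕ → ℕ → ℚ
geodeFormula a ma mb =
  (+ ((a ℕ.* ma ℕ.+ suc a ℕ.* suc mb) !)) / den
  where
  m = ma ℕ.+ mb
  d1 = suc (a ℕ.* suc m)
  d2 = suc m
  d3 = ((a ∸ 1) ℕ.* ma ℕ.+ a ℕ.* suc mb) !
  d4 = ma !
  d5 = mb !
  instance
    _ = ((a ∸ 1) ℕ.* ma ℕ.+ a ℕ.* suc mb) !≢0
    _ = ma !≢0
    _ = mb !≢0
    _ = m*n≢0 d1 d2
    _ = m*n≢0 (d1 ℕ.* d2) d3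
    _ = m*n≢0 (d1 ℕ.* d2 ℕ.* d3) d4
    _ = m*n≢0 (d1 ℕ.* d2 ℕ.* d3 ℕ.* d4) d5
  den = d1 ℕ.* d2 ℕ.* d3 ℕ.* d4 ℕ.* d5

{-# OPTIONS --safe #-}
module Submission where

open import Algebra.Bundles using (Semiring)
import Algebra.Construct.Pointwise as Pointwise
open import Data.Bool using (true)
import Data.Integer as ℤ
import Data.Integer.Properties as ℤ
open import Data.List using (List; []; _∷_; foldr; applyUpTo)
open import Data.Nat as ℕ using (ℕ; zero; suc; _≤_; s≤s; z≤n; _∸_; _!)
import Data.Nat.Properties as ℕ
open import Data.Nat.Tactic.RingSolver using (solve-∀)
open import Data.Product using (_,_)
open import Data.Rational using (ℚ; 0ℚ; 1ℚ; _/_; 1/_)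
import Data.Rational.Properties as ℚₚ
open import Function using (_∘_)
open import Relation.Binary.PropositionalEquality using (_≡_; refl; sym; trans; cong; cong₂; module ≡-Reasoning)

open import Defs

-- Setting every variable other than s_a and s_(a+1) to zero is a ring homomorphism onto
-- ℚ[[x,y]] (x = s_a, y = s_(a+1)); it sends S to a series s with s = 1 + x s^a + y s^(a+1)
-- and G to a series g with s − 1 = (x + y) g. Multiplying the equation by s^r gives
-- s^(r+1) = s^r + x s^(a+r) + y s^(a+1+r), which determines the coefficients of all powers of s
-- recursively. The Lagrange-inversion closed form r (r−1+N)! / ((r+D)! i! j!) for the
-- coefficient of x^i y^j in s^r, where N = a i + (a+1) j and D = N − i − j, satisfies the same
-- recursion: after extracting a common factor it reduces to the polynomial identity
-- (r+1)(r+N) = r (r+1+D) + (a+r) i + (a+1+r) j. Finally, (x + y) g determines g, and the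
-- claimed formula for g, multiplied by x + y, reproduces the coefficients of s − 1 by a
-- similar identity.

module PowerSeries {c ℓ} (R : Semiring c ℓ) where

  open Semiring R renaming (refl to ≈-refl; sym to ≈-sym; trans to ≈-trans)
  open import Algebra.Properties.CommutativeSemigroup +-commutativeSemigroup using (interchange)
  open import Relation.Binary.Reasoning.Setoid setoid

  R[[X]] : Set c
  R[[X]] = ℕ → Carrier

  infix  4 _≋_
  infixl 6 _⊕_
  infixl 7 _⊗_
  infixr 8 _·_

  _≋_ : R[[X]] → R[[X]] → Set ℓ
  f ≋ g = ∀ n → f n ≈ g n

  𝟘 𝟙 : R[[X]]
  𝟘 _       = 0#
  𝟙 zero    = 1#
  𝟙 (suc _) = 0#

  _⊕_ : R[[X]] → R[[X]] → R[[X]]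
  (f ⊕ g) n = f n + g n

  _·_ : Carrier → R[[X]] → R[[X]]
  (k · f) n = k * f n

  X*_ : R[[X]] → R[[X]]
  (X* f) zero    = 0#
  (X* f) (suc n) = f n

  -- Recursion on the first factor, rather than the finite sum of ⊗-as-sum, makes
  -- associativity provable by structural induction.
  _⊗_ : R[[X]] → R[[X]] → R[[X]]
  (f ⊗ g) zero    = f 0 * g 0
  (f ⊗ g) (suc n) = f 0 * g (suc n) + ((f ∘ suc) ⊗ g) n

  X*-cong : ∀ {f g} → f ≋ g → X* f ≋ X* g
  X*-cong f≋g zero    = ≈-refl
  X*-cong f≋g (suc n) = f≋g n

  X*-distrib-⊕ : ∀ f g → X* (f ⊕ g) ≋ X* f ⊕ X* g
  X*-distrib-⊕ f g zero    = ≈-sym (+-identityˡ 0#)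
  X*-distrib-⊕ f g (suc n) = ≈-refl

  ⊗-cong : ∀ {f f′ g g′} → f ≋ f′ → g ≋ g′ → f ⊗ g ≋ f′ ⊗ g′
  ⊗-cong f≋f′ g≋g′ zero    = *-cong (f≋f′ 0) (g≋g′ 0)
  ⊗-cong f≋f′ g≋g′ (suc n) = +-cong (*-cong (f≋f′ 0) (g≋g′ (suc n))) (⊗-cong (f≋f′ ∘ suc) g≋g′ n)

  ⊗-zeroˡ : ∀ g → 𝟘 ⊗ g ≋ 𝟘
  ⊗-zeroˡ g zero    = zeroˡ (g 0)
  ⊗-zeroˡ g (suc n) = ≈-trans (+-cong (zeroˡ (g (suc n))) (⊗-zeroˡ g n)) (+-identityˡ 0#)

  ⊗-zeroʳ : ∀ f → f ⊗ 𝟘 ≋ 𝟘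
  ⊗-zeroʳ f zero    = zeroʳ (f 0)
  ⊗-zeroʳ f (suc n) = ≈-trans (+-cong (zeroʳ (f 0)) (⊗-zeroʳ (f ∘ suc) n)) (+-identityˡ 0#)

  ⊗-identityˡ : ∀ g → 𝟙 ⊗ g ≋ g
  ⊗-identityˡ g zero    = *-identityˡ (g 0)
  ⊗-identityˡ g (suc n) = ≈-trans (+-cong (*-identityˡ (g (suc n))) (⊗-zeroˡ g n)) (+-identityʳ (g (suc n)))

  ⊗-identityʳ : ∀ f → f ⊗ 𝟙 ≋ f
  ⊗-identityʳ f zero    = *-identityʳ (f 0)
  ⊗-identityʳ f (suc n) = ≈-trans (+-cong (zeroʳ (f 0)) (⊗-identityʳ (f ∘ suc) n)) (+-identityˡ (f (suc n)))

  ⊗-distribˡ : ∀ h f g → h ⊗ (f ⊕ g) ≋ h ⊗ f ⊕ h ⊗ g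
  ⊗-distribˡ h f g zero    = distribˡ (h 0) (f 0) (g 0)
  ⊗-distribˡ h f g (suc n) = ≈-trans
    (+-cong (distribˡ (h 0) (f (suc n)) (g (suc n))) (⊗-distribˡ (h ∘ suc) f g n))
    (interchange _ _ _ _)

  ⊗-distribʳ : ∀ h f g → (f ⊕ g) ⊗ h ≋ f ⊗ h ⊕ g ⊗ h
  ⊗-distribʳ h f g zero    = distribʳ (h 0) (f 0) (g 0)
  ⊗-distribʳ h f g (suc n) = ≈-trans
    (+-cong (distribʳ (h (suc n)) (f 0) (g 0)) (⊗-distribʳ h (f ∘ suc) (g ∘ suc) n))
    (interchange _ _ _ _)

  ·-assoc-⊗ : ∀ k f g → (k · f) ⊗ g ≋ k · (f ⊗ g)
  ·-assoc-⊗ k f g zero    = *-assoc k (f 0) (g 0)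
  ·-assoc-⊗ k f g (suc n) = ≈-trans
    (+-cong (*-assoc k (f 0) (g (suc n))) (·-assoc-⊗ k (f ∘ suc) g n))
    (≈-sym (distribˡ k _ _))

  X*-assoc-⊗ : ∀ f g → (X* f) ⊗ g ≋ X* (f ⊗ g)
  X*-assoc-⊗ f g zero    = zeroˡ (g 0)
  X*-assoc-⊗ f g (suc n) = ≈-trans (+-congʳ (zeroˡ (g (suc n)))) (+-identityˡ ((f ⊗ g) n))

  ⊗-assoc : ∀ f g h → (f ⊗ g) ⊗ h ≋ f ⊗ (g ⊗ h)
  ⊗-assoc f g h zero    = *-assoc (f 0) (g 0) (h 0)
  ⊗-assoc f g h (suc n) = begin
    (f 0 * g 0) * h (suc n) + ((f 0 · (g ∘ suc) ⊕ (f ∘ suc) ⊗ g) ⊗ h) n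
      ≈⟨ +-cong (*-assoc (f 0) (g 0) (h (suc n))) (⊗-distribʳ h (f 0 · (g ∘ suc)) ((f ∘ suc) ⊗ g) n) ⟩
    f 0 * (g 0 * h (suc n)) + (((f 0 · (g ∘ suc)) ⊗ h) n + (((f ∘ suc) ⊗ g) ⊗ h) n)
      ≈⟨ +-congˡ (+-cong (·-assoc-⊗ (f 0) (g ∘ suc) h n) (⊗-assoc (f ∘ suc) g h n)) ⟩
    f 0 * (g 0 * h (suc n)) + (f 0 * ((g ∘ suc) ⊗ h) n + ((f ∘ suc) ⊗ (g ⊗ h)) n)
      ≈⟨ +-assoc _ _ _ ⟨
    (f 0 * (g 0 * h (suc n)) + f 0 * ((g ∘ suc) ⊗ h) n) + ((f ∘ suc) ⊗ (g ⊗ h)) n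
      ≈⟨ +-congʳ (distribˡ (f 0) _ _) ⟨
    f 0 * (g ⊗ h) (suc n) + ((f ∘ suc) ⊗ (g ⊗ h)) n ∎

  ⊗-as-sum : ∀ f g n → (f ⊗ g) n ≈ foldr _+_ 0# (applyUpTo (λ d → f d * g (n ∸ d)) (suc n))
  ⊗-as-sum f g zero    = ≈-sym (+-identityʳ _)
  ⊗-as-sum f g (suc n) = +-congˡ (⊗-as-sum (f ∘ suc) g n)

  semiring : Semiring c ℓ
  semiring = record
    { _≈_        = _≋_
    ; _+_        = _⊕_
    ; _*_        = _⊗_
    ; 0#         = 𝟘
    ; 1#         = 𝟙
    ; isSemiring = record
      { isSemiringWithoutAnnihilatingZero = record
        { +-isCommutativeMonoid = Pointwise.isCommutativeMonoid ℕ +-isCommutativeMonoid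
        ; *-cong     = ⊗-cong
        ; *-assoc    = ⊗-assoc
        ; *-identity = ⊗-identityˡ , ⊗-identityʳ
        ; distrib    = ⊗-distribˡ , ⊗-distribʳ
        }
      ; zero = ⊗-zeroˡ , ⊗-zeroʳ
      }
    }

module _ {c ℓ} (R : Semiring c ℓ) where

  open Semiring R renaming (trans to ≈-trans)
  open import Algebra.Properties.Semiring.Exp R using (_^_; ^-homo-*)
  open import Relation.Binary.Reasoning.Setoid setoid

  ^-suc-of-root : ∀ {s x y} a → s ≈ 1# + (x * s ^ a + y * s ^ suc a) →
                  ∀ r → s ^ suc r ≈ s ^ r + (x * s ^ (a ℕ.+ r) + y * s ^ (suc a ℕ.+ r))
  ^-suc-of-root {s} {x} {y} a root r = begin
    s * s ^ r
      ≈⟨ *-congʳ root ⟩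
    (1# + (x * s ^ a + y * s ^ suc a)) * s ^ r
      ≈⟨ ≈-trans (distribʳ _ _ _) (+-cong (*-identityˡ _) (distribʳ _ _ _)) ⟩
    s ^ r + (x * s ^ a * s ^ r + y * s ^ suc a * s ^ r)
      ≈⟨ +-congˡ (+-cong (*-assoc x _ _) (*-assoc y _ _)) ⟩
    s ^ r + (x * (s ^ a * s ^ r) + y * (s ^ suc a * s ^ r))
      ≈⟨ +-congˡ (+-cong (*-congˡ (^-homo-* s a r)) (*-congˡ (^-homo-* s (suc a) r))) ⟨
    s ^ r + (x * s ^ (a ℕ.+ r) + y * s ^ (suc a ℕ.+ r)) ∎

module RationalFactorials where

  open import Data.Integer using (+_)
  open import Data.Rational.Literals using (fromℤ)
  open import Data.Rational.Solver using (module +-*-Solver)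
  import Data.Rational.Unnormalised as ℚᵘ
  import Data.Rational.Unnormalised.Properties as ℚᵘ
  open import Data.Rational using (_+_; _*_)
  open +-*-Solver using (solve; _:=_; _:*_)
  open ≡-Reasoning

  fromℕ : ℕ → ℚ
  fromℕ n = fromℤ (+ n)

  fromℕ-+ : ∀ m n → fromℕ (m ℕ.+ n) ≡ fromℕ m + fromℕ n
  fromℕ-+ m n = begin
    fromℕ (m ℕ.+ n)                   ≡⟨ ℚₚ.↥p/↧p≡p (fromℕ (m ℕ.+ n)) ⟨
    + (m ℕ.+ n) / 1                   ≡⟨ cong (_/ 1) (cong₂ ℤ._+_ (ℤ.*-identityʳ (+ m)) (ℤ.*-identityʳ (+ n))) ⟨
    (+ m ℤ.* + 1 ℤ.+ + n ℤ.* + 1) / 1 ∎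

  fromℕ-* : ∀ m n → fromℕ (m ℕ.* n) ≡ fromℕ m * fromℕ n
  fromℕ-* m n = begin
    fromℕ (m ℕ.* n)    ≡⟨ ℚₚ.↥p/↧p≡p (fromℕ (m ℕ.* n)) ⟨
    + (m ℕ.* n) / 1    ≡⟨ cong (_/ 1) (ℤ.pos-* m n) ⟩
    (+ m ℤ.* + n) / 1  ∎

  fromℕ-*-merge : ∀ m n p → fromℕ m * (fromℕ n * p) ≡ fromℕ (m ℕ.* n) * p
  fromℕ-*-merge m n p = trans (sym (ℚₚ.*-assoc (fromℕ m) (fromℕ n) p)) (cong (_* p) (sym (fromℕ-* m n)))

  fromℕ-+-distrib : ∀ m n p → fromℕ (m ℕ.+ n) * p ≡ fromℕ m * p + fromℕ n * p
  fromℕ-+-distrib m n p = trans (cong (_* p) (fromℕ-+ m n)) (ℚₚ.*-distribʳ-+ p (fromℕ m) (fromℕ n))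

  /-*-cancel : ∀ n d .{{_ : ℕ.NonZero d}} → (+ n / d) * fromℕ d ≡ fromℕ n
  /-*-cancel n (suc d) = ℚₚ.toℚᵘ-injective (ℚᵘ.≃-trans (ℚₚ.toℚᵘ-homo-* (+ n / suc d) (fromℕ (suc d)))
    (ℚᵘ.≃-trans (ℚᵘ.*-congʳ (ℚₚ.toℚᵘ-fromℚᵘ (ℚᵘ.mkℚᵘ (+ n) d))) (ℚᵘ.*≡* eq)))
    where
    eq : (+ n ℤ.* + suc d) ℤ.* + 1 ≡ + n ℤ.* + suc (d ℕ.* 1)
    eq = trans (ℤ.*-identityʳ _) (cong (λ t → + n ℤ.* + suc t) (sym (ℕ.*-identityʳ d)))

  /-unique : ∀ {p} n d .{{_ : ℕ.NonZero d}} → p * fromℕ d ≡ fromℕ n → + n / d ≡ p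
  /-unique {p} n d p*d≡n = begin
    + n / d                             ≡⟨ ℚₚ.*-identityʳ (+ n / d) ⟨
    + n / d * 1ℚ                        ≡⟨ cong (+ n / d *_) (ℚₚ.*-inverseʳ (fromℕ d)) ⟨
    + n / d * (fromℕ d * 1/ fromℕ d)    ≡⟨ ℚₚ.*-assoc (+ n / d) (fromℕ d) (1/ fromℕ d) ⟨
    + n / d * fromℕ d * 1/ fromℕ d      ≡⟨ cong (_* 1/ fromℕ d) (trans (/-*-cancel n d) (sym p*d≡n)) ⟩
    p * fromℕ d * 1/ fromℕ d            ≡⟨ ℚₚ.*-assoc p (fromℕ d) (1/ fromℕ d) ⟩
    p * (fromℕ d * 1/ fromℕ d)          ≡⟨ cong (p *_) (ℚₚ.*-inverseʳ (fromℕ d)) ⟩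
    p * 1ℚ                              ≡⟨ ℚₚ.*-identityʳ p ⟩
    p                                   ∎

  fromℕ-*-cancel : ∀ m n p → fromℕ (suc m ℕ.* suc n) * (p * (1/ fromℕ (suc m) * 1/ fromℕ (suc n))) ≡ p
  fromℕ-*-cancel m n p = begin
    fromℕ (suc m ℕ.* suc n) * (p * (u * v))
      ≡⟨ cong (_* (p * (u * v))) (fromℕ-* (suc m) (suc n)) ⟩
    fromℕ (suc m) * fromℕ (suc n) * (p * (u * v))
      ≡⟨ solve 5 (λ M N p u v → M :* N :* (p :* (u :* v)) := p :* (M :* u :* (N :* v))) refl
           (fromℕ (suc m)) (fromℕ (suc n)) p u v ⟩
    p * (fromℕ (suc m) * u * (fromℕ (suc n) * v))
      ≡⟨ cong (p *_) (cong₂ _*_ (ℚₚ.*-inverseʳ (fromℕ (suc m))) (ℚₚ.*-inverseʳ (fromℕ (suc n)))) ⟩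
    p * 1ℚ
      ≡⟨ ℚₚ.*-identityʳ p ⟩
    p ∎
    where
    u = 1/ fromℕ (suc m)
    v = 1/ fromℕ (suc n)

  [_]! : ℕ → ℚ
  [ n ]! = fromℕ (n !)

  1/[_]! : ℕ → ℚ
  1/[ n ]! = 1/ fromℕ (n !)
    where instance _ = n ℕ.!≢0

  !-inverseʳ : ∀ n → [ n ]! * 1/[ n ]! ≡ 1ℚ
  !-inverseʳ n = ℚₚ.*-inverseʳ (fromℕ (n !))
    where instance _ = n ℕ.!≢0

  []!-suc : ∀ n → [ suc n ]! ≡ fromℕ (suc n) * [ n ]!
  []!-suc n = fromℕ-* (suc n) (n !)

  1/[]!-suc : ∀ n → 1/[ n ]! ≡ fromℕ (suc n) * 1/[ suc n ]!
  1/[]!-suc n = begin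
    1/[ n ]!                                            ≡⟨ ℚₚ.*-identityʳ 1/[ n ]! ⟨
    1/[ n ]! * 1ℚ                                       ≡⟨ cong (1/[ n ]! *_) (!-inverseʳ (suc n)) ⟨
    1/[ n ]! * ([ suc n ]! * 1/[ suc n ]!)              ≡⟨ cong (λ t → 1/[ n ]! * (t * 1/[ suc n ]!)) ([]!-suc n) ⟩
    1/[ n ]! * (fromℕ (suc n) * [ n ]! * 1/[ suc n ]!)  ≡⟨ solve 4 (λ u k f v → u :* (k :* f :* v) := k :* v :* (f :* u)) refl
                                                             1/[ n ]! (fromℕ (suc n)) [ n ]! 1/[ suc n ]! ⟩
    fromℕ (suc n) * 1/[ suc n ]! * ([ n ]! * 1/[ n ]!)  ≡⟨ cong (fromℕ (suc n) * 1/[ suc n ]! *_) (!-inverseʳ n) ⟩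
    fromℕ (suc n) * 1/[ suc n ]! * 1ℚ                   ≡⟨ ℚₚ.*-identityʳ _ ⟩
    fromℕ (suc n) * 1/[ suc n ]!                        ∎

  factorialRatio : ℕ → ℕ → ℕ → ℕ → ℚ
  factorialRatio n d i j = [ n ]! * 1/[ d ]! * 1/[ i ]! * 1/[ j ]!

  factorialRatio-sucⁿ : ∀ n d i j → factorialRatio (suc n) d i j ≡ fromℕ (suc n) * factorialRatio n d i j
  factorialRatio-sucⁿ n d i j =
    trans (cong (λ t → t * 1/[ d ]! * 1/[ i ]! * 1/[ j ]!) ([]!-suc n))
      (solve 5 (λ k f u v w → k :* f :* u :* v :* w := k :* (f :* u :* v :* w)) refl
        (fromℕ (suc n)) [ n ]! 1/[ d ]! 1/[ i ]! 1/[ j ]!)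

  factorialRatio-sucᵈ : ∀ n d i j → factorialRatio n d i j ≡ fromℕ (suc d) * factorialRatio n (suc d) i j
  factorialRatio-sucᵈ n d i j =
    trans (cong (λ t → [ n ]! * t * 1/[ i ]! * 1/[ j ]!) (1/[]!-suc d))
      (solve 5 (λ f k u v w → f :* (k :* u) :* v :* w := k :* (f :* u :* v :* w)) refl
        [ n ]! (fromℕ (suc d)) 1/[ suc d ]! 1/[ i ]! 1/[ j ]!)

  factorialRatio-sucⁱ : ∀ n d i j → factorialRatio n d i j ≡ fromℕ (suc i) * factorialRatio n d (suc i) j
  factorialRatio-sucⁱ n d i j =
    trans (cong (λ t → [ n ]! * 1/[ d ]! * t * 1/[ j ]!) (1/[]!-suc i))
      (solve 5 (λ f u k v w → f :* u :* (k :* v) :* w := k :* (f :* u :* v :* w)) refl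
        [ n ]! 1/[ d ]! (fromℕ (suc i)) 1/[ suc i ]! 1/[ j ]!)

  factorialRatio-sucʲ : ∀ n d i j → factorialRatio n d i j ≡ fromℕ (suc j) * factorialRatio n d i (suc j)
  factorialRatio-sucʲ n d i j =
    trans (cong (λ t → [ n ]! * 1/[ d ]! * 1/[ i ]! * t) (1/[]!-suc j))
      (solve 5 (λ f u v k w → f :* u :* v :* (k :* w) := k :* (f :* u :* v :* w)) refl
        [ n ]! 1/[ d ]! 1/[ i ]! (fromℕ (suc j)) 1/[ suc j ]!)

applyUpTo-cong : ∀ {A : Set} {f g : ℕ → A} → (∀ d → f d ≡ g d) → ∀ n → applyUpTo f n ≡ applyUpTo g n
applyUpTo-cong f≗g zero    = refl
applyUpTo-cong f≗g (suc n) = cong₂ _∷_ (f≗g 0) (applyUpTo-cong (f≗g ∘ suc) n)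

module Bivariate where

  open import Algebra.Bundles using (CommutativeRing)
  open import Algebra.Properties.Group ℚₚ.+-0-group using (∙-cancelʳ)
  open import Data.List using (map)
  import Data.List.Properties as List
  open import Data.Rational using (_+_; _*_)
  open ≡-Reasoning

  ℚ-semiring : Semiring _ _
  ℚ-semiring = CommutativeRing.semiring ℚₚ.+-*-commutativeRing

  -- F i j is the coefficient of x^i y^j: series in x whose coefficients are series in y.
  module Y = PowerSeries ℚ-semiring

  open PowerSeries Y.semiring public renaming (R[[X]] to ℚ[[x,y]])
  open import Algebra.Properties.Semiring.Exp semiring public using (_^_)

  Y*_ : ℚ[[x,y]] → ℚ[[x,y]]
  (Y* F) i = Y.X* (F i)

  x y : ℚ[[x,y]]
  x = X* 𝟙
  y = Y* 𝟙

  Y*-assoc-⊗ : ∀ F G → (Y* F) ⊗ G ≋ Y* (F ⊗ G)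
  Y*-assoc-⊗ F G zero      = Y.X*-assoc-⊗ (F 0) (G 0)
  Y*-assoc-⊗ F G (suc n) j = trans
    (cong₂ _+_ (Y.X*-assoc-⊗ (F 0) (G (suc n)) j) (Y*-assoc-⊗ (F ∘ suc) G n j))
    (sym (Y.X*-distrib-⊕ (F 0 Y.⊗ G (suc n)) (((F ∘ suc) ⊗ G) n) j))

  x-⊗ : ∀ F → x ⊗ F ≋ X* F
  x-⊗ F i j = trans (X*-assoc-⊗ 𝟙 F i j) (X*-cong (⊗-identityˡ F) i j)

  y-⊗ : ∀ F → y ⊗ F ≋ Y* F
  y-⊗ F i j = trans (Y*-assoc-⊗ 𝟙 F i j) (Y.X*-cong (⊗-identityˡ F i) j)

  x⊕y-⊗ : ∀ F i j → ((x ⊕ y) ⊗ F) (suc i) j ≡ F i j + (Y* F) (suc i) j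
  x⊕y-⊗ F i j = trans (⊗-distribʳ F x y (suc i) j) (cong₂ _+_ (x-⊗ F (suc i) j) (y-⊗ F (suc i) j))

  x⊕y-⊗-injective : ∀ {F G} → (∀ i j → ((x ⊕ y) ⊗ F) (suc i) j ≡ ((x ⊕ y) ⊗ G) (suc i) j) → F ≋ G
  x⊕y-⊗-injective {F} {G} same i j = agree j i
    where
    agree : ∀ j i → F i j ≡ G i j
    agree zero    i = begin
      F i 0                     ≡⟨ ℚₚ.+-identityʳ (F i 0) ⟨
      F i 0 + 0ℚ                ≡⟨ x⊕y-⊗ F i 0 ⟨
      ((x ⊕ y) ⊗ F) (suc i) 0   ≡⟨ same i 0 ⟩
      ((x ⊕ y) ⊗ G) (suc i) 0   ≡⟨ x⊕y-⊗ G i 0 ⟩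
      G i 0 + 0ℚ                ≡⟨ ℚₚ.+-identityʳ (G i 0) ⟩
      G i 0                     ∎
    agree (suc j) i = ∙-cancelʳ (F (suc i) j) (F i (suc j)) (G i (suc j)) (begin
      F i (suc j) + F (suc i) j       ≡⟨ x⊕y-⊗ F i (suc j) ⟨
      ((x ⊕ y) ⊗ F) (suc i) (suc j)   ≡⟨ same i (suc j) ⟩
      ((x ⊕ y) ⊗ G) (suc i) (suc j)   ≡⟨ x⊕y-⊗ G i (suc j) ⟩
      G i (suc j) + G (suc i) j       ≡⟨ cong (G i (suc j) +_) (agree j (suc i)) ⟨
      G i (suc j) + F (suc i) j       ∎)

  foldr-⊕-apply : ∀ (L : List Y.R[[X]]) j → foldr Y._⊕_ Y.𝟘 L j ≡ sumℚ (map (λ h → h j) L)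
  foldr-⊕-apply []      j = refl
  foldr-⊕-apply (h ∷ L) j = cong (h j +_) (foldr-⊕-apply L j)

  ⊗-as-double-sum : ∀ F G i j →
    (F ⊗ G) i j ≡ sumℚ (applyUpTo (λ d → sumℚ (applyUpTo (λ e → F d e * G (i ∸ d) (j ∸ e)) (suc j))) (suc i))
  ⊗-as-double-sum F G i j = begin
    (F ⊗ G) i j
      ≡⟨ ⊗-as-sum F G i j ⟩
    foldr Y._⊕_ Y.𝟘 (applyUpTo (λ d → F d Y.⊗ G (i ∸ d)) (suc i)) j
      ≡⟨ foldr-⊕-apply (applyUpTo (λ d → F d Y.⊗ G (i ∸ d)) (suc i)) j ⟩
    sumℚ (map (λ h → h j) (applyUpTo (λ d → F d Y.⊗ G (i ∸ d)) (suc i)))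
      ≡⟨ cong sumℚ (List.map-applyUpTo (λ d → F d Y.⊗ G (i ∸ d)) (λ h → h j) (suc i)) ⟩
    sumℚ (applyUpTo (λ d → (F d Y.⊗ G (i ∸ d)) j) (suc i))
      ≡⟨ cong sumℚ (applyUpTo-cong (λ d → Y.⊗-as-sum (F d) (G (i ∸ d)) j) (suc i)) ⟩
    sumℚ (applyUpTo (λ d → sumℚ (applyUpTo (λ e → F d e * G (i ∸ d) (j ∸ e)) (suc j))) (suc i)) ∎

-- Exponent identities for Lagrange, stated with a = suc b and N, D unfolded: solve-∀ only
-- proves goals whose free variables are all quantified.
private
  multiplicities : ∀ b r i j →
    suc r ℕ.* (r ℕ.+ (i ℕ.* suc b ℕ.+ j ℕ.* suc (suc b))) ≡
    r ℕ.* suc (r ℕ.+ (i ℕ.* b ℕ.+ j ℕ.* suc b)) ℕ.+ ((suc b ℕ.+ r) ℕ.* i ℕ.+ (suc (suc b) ℕ.+ r) ℕ.* j)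
  multiplicities = solve-∀

  X-shift-N : ∀ b r i j →
    r ℕ.+ (suc i ℕ.* suc b ℕ.+ j ℕ.* suc (suc b)) ≡ suc (b ℕ.+ r ℕ.+ (i ℕ.* suc b ℕ.+ j ℕ.* suc (suc b)))
  X-shift-N = solve-∀

  Y-shift-N : ∀ b r i j →
    r ℕ.+ (i ℕ.* suc b ℕ.+ suc j ℕ.* suc (suc b)) ≡ suc (suc b ℕ.+ r ℕ.+ (i ℕ.* suc b ℕ.+ j ℕ.* suc (suc b)))
  Y-shift-N = solve-∀

  X-shift-D : ∀ b r i j → suc (b ℕ.+ r) ℕ.+ (i ℕ.* b ℕ.+ j ℕ.* suc b) ≡ suc r ℕ.+ (suc i ℕ.* b ℕ.+ j ℕ.* suc b)
  X-shift-D = solve-∀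

  Y-shift-D : ∀ b r i j → suc (suc b ℕ.+ r) ℕ.+ (i ℕ.* b ℕ.+ j ℕ.* suc b) ≡ suc r ℕ.+ (i ℕ.* b ℕ.+ suc j ℕ.* suc b)
  Y-shift-D = solve-∀

  geode-N : ∀ b i j → suc b ℕ.* i ℕ.+ suc (suc b) ℕ.* suc j ≡ suc (suc i ℕ.* suc b ℕ.+ j ℕ.* suc (suc b))
  geode-N = solve-∀

  geode-D : ∀ b i j → b ℕ.* i ℕ.+ suc b ℕ.* suc j ≡ suc (suc i ℕ.* b ℕ.+ j ℕ.* suc b)
  geode-D = solve-∀

  geode-multiplicities : ∀ b i j →
    suc (suc i ℕ.* suc b ℕ.+ j ℕ.* suc (suc b)) ℕ.* suc i ℕ.+ suc (suc i ℕ.* b ℕ.+ j ℕ.* suc b) ℕ.* j ≡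
    suc (suc b ℕ.* suc (i ℕ.+ j)) ℕ.* suc (i ℕ.+ j)
  geode-multiplicities = solve-∀

module Lagrange (b : ℕ) where

  open Bivariate
  open RationalFactorials
  open import Data.Rational using (_+_; _*_)
  open import Data.Rational.Solver using (module +-*-Solver)
  open +-*-Solver using (solve; _:=_; _:*_)
  open ≡-Reasoning

  a : ℕ
  a = suc b

  N D : ℕ → ℕ → ℕ
  N i j = i ℕ.* a ℕ.+ j ℕ.* suc a
  D i j = i ℕ.* b ℕ.+ j ℕ.* a

  coeff : ℕ → ℚ[[x,y]]
  coeff zero        = 𝟙
  coeff (suc r) i j = fromℕ (suc r) * factorialRatio (r ℕ.+ N i j) (suc r ℕ.+ D i j) i j

  coeff-constant : ∀ r → coeff r 0 0 ≡ 1ℚ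
  coeff-constant zero    = refl
  coeff-constant (suc r) = begin
    fromℕ (suc r) * factorialRatio (r ℕ.+ 0) (suc r ℕ.+ 0) 0 0
      ≡⟨ cong₂ (λ n d → fromℕ (suc r) * factorialRatio n d 0 0) (ℕ.+-identityʳ r) (ℕ.+-identityʳ (suc r)) ⟩
    fromℕ (suc r) * factorialRatio r (suc r) 0 0
      ≡⟨ factorialRatio-sucⁿ r (suc r) 0 0 ⟨
    [ suc r ]! * 1/[ suc r ]! * 1ℚ * 1ℚ
      ≡⟨ trans (ℚₚ.*-identityʳ _) (ℚₚ.*-identityʳ _) ⟩
    [ suc r ]! * 1/[ suc r ]!
      ≡⟨ !-inverseʳ (suc r) ⟩
    1ℚ ∎

  -- When r + N i j = suc T, every term of the recursion for coeff (suc r) i j is a natural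
  -- multiple of W r i j T.
  W : ℕ → ℕ → ℕ → ℕ → ℚ
  W r i j T = factorialRatio T (suc r ℕ.+ D i j) i j

  coeff-suc≡multiple : ∀ r i j {T} → r ℕ.+ N i j ≡ suc T → coeff (suc r) i j ≡ fromℕ (suc r ℕ.* suc T) * W r i j T
  coeff-suc≡multiple r i j {T} eq = begin
    fromℕ (suc r) * factorialRatio (r ℕ.+ N i j) (suc r ℕ.+ D i j) i j
      ≡⟨ cong (λ n → fromℕ (suc r) * factorialRatio n (suc r ℕ.+ D i j) i j) eq ⟩
    fromℕ (suc r) * factorialRatio (suc T) (suc r ℕ.+ D i j) i j
      ≡⟨ cong (fromℕ (suc r) *_) (factorialRatio-sucⁿ T (suc r ℕ.+ D i j) i j) ⟩
    fromℕ (suc r) * (fromℕ (suc T) * W r i j T)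
      ≡⟨ fromℕ-*-merge (suc r) (suc T) (W r i j T) ⟩
    fromℕ (suc r ℕ.* suc T) * W r i j T ∎

  coeff≡multiple : ∀ r i j {T} → r ℕ.+ N i j ≡ suc T → coeff r i j ≡ fromℕ (r ℕ.* suc (r ℕ.+ D i j)) * W r i j T
  coeff≡multiple zero    zero    zero    ()
  coeff≡multiple zero    zero    (suc j) {T} _  = sym (ℚₚ.*-zeroˡ (W 0 0 (suc j) T))
  coeff≡multiple zero    (suc i) j       {T} _  = sym (ℚₚ.*-zeroˡ (W 0 (suc i) j T))
  coeff≡multiple (suc r) i       j       {T} eq = begin
    fromℕ (suc r) * factorialRatio (r ℕ.+ N i j) (suc r ℕ.+ D i j) i j
      ≡⟨ cong (λ n → fromℕ (suc r) * factorialRatio n (suc r ℕ.+ D i j) i j) (ℕ.suc-injective eq) ⟩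
    fromℕ (suc r) * factorialRatio T (suc r ℕ.+ D i j) i j
      ≡⟨ cong (fromℕ (suc r) *_) (factorialRatio-sucᵈ T (suc r ℕ.+ D i j) i j) ⟩
    fromℕ (suc r) * (fromℕ (suc (suc r ℕ.+ D i j)) * W (suc r) i j T)
      ≡⟨ fromℕ-*-merge (suc r) (suc (suc r ℕ.+ D i j)) (W (suc r) i j T) ⟩
    fromℕ (suc r ℕ.* suc (suc r ℕ.+ D i j)) * W (suc r) i j T ∎

  X*-coeff≡multiple : ∀ r i j {T} → r ℕ.+ N i j ≡ suc T →
                      (X* coeff (a ℕ.+ r)) i j ≡ fromℕ ((a ℕ.+ r) ℕ.* i) * W r i j T
  X*-coeff≡multiple r zero    j {T} _ =
    sym (trans (cong (λ k → fromℕ k * W r 0 j T) (ℕ.*-zeroʳ (a ℕ.+ r))) (ℚₚ.*-zeroˡ (W r 0 j T)))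
  X*-coeff≡multiple r (suc i) j {T} eq = begin
    fromℕ (a ℕ.+ r) * factorialRatio (b ℕ.+ r ℕ.+ N i j) (a ℕ.+ r ℕ.+ D i j) i j
      ≡⟨ cong₂ (λ n d → fromℕ (a ℕ.+ r) * factorialRatio n d i j)
               (ℕ.suc-injective (trans (sym (X-shift-N b r i j)) eq)) (X-shift-D b r i j) ⟩
    fromℕ (a ℕ.+ r) * factorialRatio T (suc r ℕ.+ D (suc i) j) i j
      ≡⟨ cong (fromℕ (a ℕ.+ r) *_) (factorialRatio-sucⁱ T (suc r ℕ.+ D (suc i) j) i j) ⟩
    fromℕ (a ℕ.+ r) * (fromℕ (suc i) * W r (suc i) j T)
      ≡⟨ fromℕ-*-merge (a ℕ.+ r) (suc i) (W r (suc i) j T) ⟩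
    fromℕ ((a ℕ.+ r) ℕ.* suc i) * W r (suc i) j T ∎

  Y*-coeff≡multiple : ∀ r i j {T} → r ℕ.+ N i j ≡ suc T →
                      (Y* coeff (suc a ℕ.+ r)) i j ≡ fromℕ ((suc a ℕ.+ r) ℕ.* j) * W r i j T
  Y*-coeff≡multiple r i zero {T} _ =
    sym (trans (cong (λ k → fromℕ k * W r i 0 T) (ℕ.*-zeroʳ (suc a ℕ.+ r))) (ℚₚ.*-zeroˡ (W r i 0 T)))
  Y*-coeff≡multiple r i (suc j) {T} eq = begin
    fromℕ (suc a ℕ.+ r) * factorialRatio (a ℕ.+ r ℕ.+ N i j) (suc a ℕ.+ r ℕ.+ D i j) i j
      ≡⟨ cong₂ (λ n d → fromℕ (suc a ℕ.+ r) * factorialRatio n d i j)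
               (ℕ.suc-injective (trans (sym (Y-shift-N b r i j)) eq)) (Y-shift-D b r i j) ⟩
    fromℕ (suc a ℕ.+ r) * factorialRatio T (suc r ℕ.+ D i (suc j)) i j
      ≡⟨ cong (fromℕ (suc a ℕ.+ r) *_) (factorialRatio-sucʲ T (suc r ℕ.+ D i (suc j)) i j) ⟩
    fromℕ (suc a ℕ.+ r) * (fromℕ (suc j) * W r i (suc j) T)
      ≡⟨ fromℕ-*-merge (suc a ℕ.+ r) (suc j) (W r i (suc j) T) ⟩
    fromℕ ((suc a ℕ.+ r) ℕ.* suc j) * W r i (suc j) T ∎

  coeff-rec-nonconstant : ∀ r i j {T} → r ℕ.+ N i j ≡ suc T →
                          coeff (suc r) i j ≡ coeff r i j + ((X* coeff (a ℕ.+ r)) i j + (Y* coeff (suc a ℕ.+ r)) i j)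
  coeff-rec-nonconstant r i j {T} eq = begin
    coeff (suc r) i j
      ≡⟨ coeff-suc≡multiple r i j eq ⟩
    fromℕ (suc r ℕ.* suc T) * w
      ≡⟨ cong (λ k → fromℕ k * w) (trans (cong (suc r ℕ.*_) (sym eq)) (multiplicities b r i j)) ⟩
    fromℕ (r ℕ.* suc (r ℕ.+ D i j) ℕ.+ ((a ℕ.+ r) ℕ.* i ℕ.+ (suc a ℕ.+ r) ℕ.* j)) * w
      ≡⟨ trans (fromℕ-+-distrib (r ℕ.* suc (r ℕ.+ D i j)) _ w)
               (cong (fromℕ (r ℕ.* suc (r ℕ.+ D i j)) * w +_) (fromℕ-+-distrib ((a ℕ.+ r) ℕ.* i) _ w)) ⟩
    fromℕ (r ℕ.* suc (r ℕ.+ D i j)) * w + (fromℕ ((a ℕ.+ r) ℕ.* i) * w + fromℕ ((suc a ℕ.+ r) ℕ.* j) * w)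
      ≡⟨ cong₂ _+_ (coeff≡multiple r i j eq) (cong₂ _+_ (X*-coeff≡multiple r i j eq) (Y*-coeff≡multiple r i j eq)) ⟨
    coeff r i j + ((X* coeff (a ℕ.+ r)) i j + (Y* coeff (suc a ℕ.+ r)) i j) ∎
    where w = W r i j T

  coeff-rec : ∀ r → coeff (suc r) ≋ coeff r ⊕ (X* coeff (a ℕ.+ r) ⊕ Y* coeff (suc a ℕ.+ r))
  coeff-rec r zero    zero    = trans (coeff-constant (suc r)) (cong (_+ (0ℚ + 0ℚ)) (sym (coeff-constant r)))
  coeff-rec r zero    (suc j) = coeff-rec-nonconstant r zero (suc j) (ℕ.+-suc r _)
  coeff-rec r (suc i) j       = coeff-rec-nonconstant r (suc i) j (ℕ.+-suc r _)

  coeff-unique : (P : ℕ → ℚ[[x,y]]) → P 0 ≋ 𝟙 →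
                 (∀ r → P (suc r) ≋ P r ⊕ (X* P (a ℕ.+ r) ⊕ Y* P (suc a ℕ.+ r))) →
                 ∀ r → P r ≋ coeff r
  coeff-unique P P₀ P-rec r i j = agree i j r
    where
    step : ∀ r i j → P r i j ≡ coeff r i j →
           (X* P (a ℕ.+ r)) i j ≡ (X* coeff (a ℕ.+ r)) i j →
           (Y* P (suc a ℕ.+ r)) i j ≡ (Y* coeff (suc a ℕ.+ r)) i j →
           P (suc r) i j ≡ coeff (suc r) i j
    step r i j eq₀ eqₓ eqᵧ = trans (P-rec r i j) (trans (cong₂ _+_ eq₀ (cong₂ _+_ eqₓ eqᵧ)) (sym (coeff-rec r i j)))

    agree : ∀ i j r → P r i j ≡ coeff r i j
    agree i       j       zero    = P₀ i j
    agree zero    zero    (suc r) = step r 0 0 (agree 0 0 r) refl refl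
    agree (suc i) zero    (suc r) = step r (suc i) 0 (agree (suc i) 0 r) (agree i 0 (a ℕ.+ r)) refl
    agree zero    (suc j) (suc r) = step r 0 (suc j) (agree 0 (suc j) r) refl (agree 0 j (suc a ℕ.+ r))
    agree (suc i) (suc j) (suc r) =
      step r (suc i) (suc j) (agree (suc i) (suc j) r) (agree i (suc j) (a ℕ.+ r)) (agree (suc i) j (suc a ℕ.+ r))

  root-^≋coeff : ∀ s → s ≋ 𝟙 ⊕ (x ⊗ s ^ a ⊕ y ⊗ s ^ suc a) → ∀ r → s ^ r ≋ coeff r
  root-^≋coeff s root = coeff-unique (s ^_) (λ _ _ → refl) ^-rec
    where
    ^-rec : ∀ r → s ^ suc r ≋ s ^ r ⊕ (X* (s ^ (a ℕ.+ r)) ⊕ Y* (s ^ (suc a ℕ.+ r)))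
    ^-rec r i j = trans (^-suc-of-root semiring a root r i j)
                        (cong ((s ^ r) i j +_) (cong₂ _+_ (x-⊗ (s ^ (a ℕ.+ r)) i j) (y-⊗ (s ^ (suc a ℕ.+ r)) i j)))

  root≋coeff₁ : ∀ s → s ≋ 𝟙 ⊕ (x ⊗ s ^ a ⊕ y ⊗ s ^ suc a) → s ≋ coeff 1
  root≋coeff₁ s root i j = trans (sym (⊗-identityʳ s i j)) (root-^≋coeff s root 1 i j)

  1/d₁d₂ : ℕ → ℚ
  1/d₁d₂ m = 1/ fromℕ (suc (a ℕ.* suc m)) * 1/ fromℕ (suc m)

  geode : ℚ[[x,y]]
  geode i j = factorialRatio (a ℕ.* i ℕ.+ suc a ℕ.* suc j) (b ℕ.* i ℕ.+ a ℕ.* suc j) i j * 1/d₁d₂ (i ℕ.+ j)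

  -- Plays the role of W for the two terms of ((x ⊕ y) ⊗ geode) (suc i) j.
  Wᵍ : ℕ → ℕ → ℚ
  Wᵍ i j = factorialRatio (N (suc i) j) (suc (D (suc i) j)) (suc i) j * 1/d₁d₂ (i ℕ.+ j)

  geode≡multiple : ∀ i j → geode i j ≡ fromℕ (suc (N (suc i) j) ℕ.* suc i) * Wᵍ i j
  geode≡multiple i j = begin
    factorialRatio (a ℕ.* i ℕ.+ suc a ℕ.* suc j) (b ℕ.* i ℕ.+ a ℕ.* suc j) i j * 1/d₁d₂ m
      ≡⟨ cong₂ (λ n d → factorialRatio n d i j * 1/d₁d₂ m) (geode-N b i j) (geode-D b i j) ⟩
    factorialRatio (suc T) (suc E) i j * 1/d₁d₂ m
      ≡⟨ cong (_* 1/d₁d₂ m) (trans (factorialRatio-sucⁿ T (suc E) i j)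
                                   (cong (fromℕ (suc T) *_) (factorialRatio-sucⁱ T (suc E) i j))) ⟩
    fromℕ (suc T) * (fromℕ (suc i) * factorialRatio T (suc E) (suc i) j) * 1/d₁d₂ m
      ≡⟨ cong (_* 1/d₁d₂ m) (fromℕ-*-merge (suc T) (suc i) (factorialRatio T (suc E) (suc i) j)) ⟩
    fromℕ (suc T ℕ.* suc i) * factorialRatio T (suc E) (suc i) j * 1/d₁d₂ m
      ≡⟨ ℚₚ.*-assoc (fromℕ (suc T ℕ.* suc i)) (factorialRatio T (suc E) (suc i) j) (1/d₁d₂ m) ⟩
    fromℕ (suc T ℕ.* suc i) * Wᵍ i j ∎
    where
    T = N (suc i) j
    E = D (suc i) j
    m = i ℕ.+ j

  Y*-geode≡multiple : ∀ i j → (Y* geode) (suc i) j ≡ fromℕ (suc (D (suc i) j) ℕ.* j) * Wᵍ i j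
  Y*-geode≡multiple i zero    =
    sym (trans (cong (λ k → fromℕ k * Wᵍ i 0) (ℕ.*-zeroʳ (suc (D (suc i) 0)))) (ℚₚ.*-zeroˡ (Wᵍ i 0)))
  Y*-geode≡multiple i (suc j) = begin
    factorialRatio (a ℕ.* suc i ℕ.+ suc a ℕ.* suc j) (b ℕ.* suc i ℕ.+ a ℕ.* suc j) (suc i) j * 1/d₁d₂ (suc i ℕ.+ j)
      ≡⟨ cong₂ _*_ (cong₂ (λ n d → factorialRatio n d (suc i) j)
                          (cong₂ ℕ._+_ (ℕ.*-comm a (suc i)) (ℕ.*-comm (suc a) (suc j)))
                          (cong₂ ℕ._+_ (ℕ.*-comm b (suc i)) (ℕ.*-comm a (suc j))))
                   (cong 1/d₁d₂ (sym (ℕ.+-suc i j))) ⟩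
    factorialRatio T E (suc i) j * 1/d₁d₂ m
      ≡⟨ cong (_* 1/d₁d₂ m) (trans (factorialRatio-sucᵈ T E (suc i) j)
                                   (cong (fromℕ (suc E) *_) (factorialRatio-sucʲ T (suc E) (suc i) j))) ⟩
    fromℕ (suc E) * (fromℕ (suc j) * factorialRatio T (suc E) (suc i) (suc j)) * 1/d₁d₂ m
      ≡⟨ cong (_* 1/d₁d₂ m) (fromℕ-*-merge (suc E) (suc j) (factorialRatio T (suc E) (suc i) (suc j))) ⟩
    fromℕ (suc E ℕ.* suc j) * factorialRatio T (suc E) (suc i) (suc j) * 1/d₁d₂ m
      ≡⟨ ℚₚ.*-assoc (fromℕ (suc E ℕ.* suc j)) (factorialRatio T (suc E) (suc i) (suc j)) (1/d₁d₂ m) ⟩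
    fromℕ (suc E ℕ.* suc j) * Wᵍ i (suc j) ∎
    where
    T = N (suc i) (suc j)
    E = D (suc i) (suc j)
    m = i ℕ.+ suc j

  x⊕y-⊗-geode : ∀ i j → ((x ⊕ y) ⊗ geode) (suc i) j ≡ coeff 1 (suc i) j
  x⊕y-⊗-geode i j = begin
    ((x ⊕ y) ⊗ geode) (suc i) j
      ≡⟨ x⊕y-⊗ geode i j ⟩
    geode i j + (Y* geode) (suc i) j
      ≡⟨ cong₂ _+_ (geode≡multiple i j) (Y*-geode≡multiple i j) ⟩
    fromℕ (suc T ℕ.* suc i) * Wᵍ i j + fromℕ (suc E ℕ.* j) * Wᵍ i j
      ≡⟨ fromℕ-+-distrib (suc T ℕ.* suc i) (suc E ℕ.* j) (Wᵍ i j) ⟨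
    fromℕ (suc T ℕ.* suc i ℕ.+ suc E ℕ.* j) * Wᵍ i j
      ≡⟨ cong (λ k → fromℕ k * Wᵍ i j) (geode-multiplicities b i j) ⟩
    fromℕ (suc (a ℕ.* suc m) ℕ.* suc m) * (w * 1/d₁d₂ m)
      ≡⟨ fromℕ-*-cancel (a ℕ.* suc m) m w ⟩
    w
      ≡⟨ ℚₚ.*-identityˡ w ⟨
    coeff 1 (suc i) j ∎
    where
    T = N (suc i) j
    E = D (suc i) j
    m = i ℕ.+ j
    w = factorialRatio T (suc E) (suc i) j

  geodeFormula≡geode : ∀ i j → geodeFormula a i j ≡ geode i j
  geodeFormula≡geode i j = /-unique (n !) den {{den≢0}} (begin
    geode i j * fromℕ den
      ≡⟨ cong (geode i j *_) fromℕ-den ⟩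
    geode i j * (fromℕ d₁ * fromℕ d₂ * [ d ]! * [ i ]! * [ j ]!)
      ≡⟨ solve 11 (λ N d′ i′ j′ u₁ u₂ D₁ D₂ F G H →
                     N :* d′ :* i′ :* j′ :* (u₁ :* u₂) :* (D₁ :* D₂ :* F :* G :* H) :=
                     N :* (D₁ :* u₁ :* (D₂ :* u₂) :* (F :* d′) :* (G :* i′) :* (H :* j′))) refl
           [ n ]! 1/[ d ]! 1/[ i ]! 1/[ j ]! (1/ fromℕ d₁) (1/ fromℕ d₂) (fromℕ d₁) (fromℕ d₂) [ d ]! [ i ]! [ j ]! ⟩
    [ n ]! * (fromℕ d₁ * 1/ fromℕ d₁ * (fromℕ d₂ * 1/ fromℕ d₂) * ([ d ]! * 1/[ d ]!) * ([ i ]! * 1/[ i ]!) * ([ j ]! * 1/[ j ]!))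
      ≡⟨ cong ([ n ]! *_) (cong₂ _*_ (cong₂ _*_ (cong₂ _*_ (cong₂ _*_
           (ℚₚ.*-inverseʳ (fromℕ d₁)) (ℚₚ.*-inverseʳ (fromℕ d₂))) (!-inverseʳ d)) (!-inverseʳ i)) (!-inverseʳ j)) ⟩
    [ n ]! * 1ℚ
      ≡⟨ ℚₚ.*-identityʳ [ n ]! ⟩
    [ n ]! ∎)
    where
    n  = a ℕ.* i ℕ.+ suc a ℕ.* suc j
    d  = b ℕ.* i ℕ.+ a ℕ.* suc j
    m  = i ℕ.+ j
    d₁ = suc (a ℕ.* suc m)
    d₂ = suc m
    den = d₁ ℕ.* d₂ ℕ.* d ! ℕ.* i ! ℕ.* j !

    den≢0 : ℕ.NonZero den
    den≢0 = ℕ.m*n≢0 _ _ {{ℕ.m*n≢0 _ _ {{ℕ.m*n≢0 _ _ {{ℕ.m*n≢0 d₁ d₂}} {{d ℕ.!≢0}}}} {{i ℕ.!≢0}}}} {{j ℕ.!≢0}}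

    fromℕ-den : fromℕ den ≡ fromℕ d₁ * fromℕ d₂ * [ d ]! * [ i ]! * [ j ]!
    fromℕ-den = begin
      fromℕ (d₁ ℕ.* d₂ ℕ.* d ! ℕ.* i ! ℕ.* j !)
        ≡⟨ fromℕ-* (d₁ ℕ.* d₂ ℕ.* d ! ℕ.* i !) (j !) ⟩
      fromℕ (d₁ ℕ.* d₂ ℕ.* d ! ℕ.* i !) * [ j ]!
        ≡⟨ cong (_* [ j ]!) (fromℕ-* (d₁ ℕ.* d₂ ℕ.* d !) (i !)) ⟩
      fromℕ (d₁ ℕ.* d₂ ℕ.* d !) * [ i ]! * [ j ]!
        ≡⟨ cong (λ t → t * [ i ]! * [ j ]!) (fromℕ-* (d₁ ℕ.* d₂) (d !)) ⟩
      fromℕ (d₁ ℕ.* d₂) * [ d ]! * [ i ]! * [ j ]!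
        ≡⟨ cong (λ t → t * [ d ]! * [ i ]! * [ j ]!) (fromℕ-* d₁ d₂) ⟩
      fromℕ d₁ * fromℕ d₂ * [ d ]! * [ i ]! * [ j ]! ∎

module Monomials where

  open import Data.List using (map; concatMap; upTo; replicate; zipWith; _++_)
  import Data.List.Properties as List
  open import Data.Maybe using (just; nothing)
  open import Data.Rational using (_+_)
  open ≡-Reasoning

  pad : ℕ → Mono → Mono
  pad k μ = replicate k 0 ++ μ

  sumℚ-++ : ∀ xs ys → sumℚ (xs ++ ys) ≡ sumℚ xs + sumℚ ys
  sumℚ-++ []       ys = sym (ℚₚ.+-identityˡ (sumℚ ys))
  sumℚ-++ (q ∷ xs) ys = trans (cong (q +_) (sumℚ-++ xs ys)) (sym (ℚₚ.+-assoc q (sumℚ xs) (sumℚ ys)))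

  sumℚ-concatMap : ∀ {A B : Set} (F : B → ℚ) (h : A → List B) xs →
                   sumℚ (map F (concatMap h xs)) ≡ sumℚ (map (sumℚ ∘ map F ∘ h) xs)
  sumℚ-concatMap F h []       = refl
  sumℚ-concatMap F h (x ∷ xs) = begin
    sumℚ (map F (h x ++ concatMap h xs))               ≡⟨ cong sumℚ (List.map-++ F (h x) (concatMap h xs)) ⟩
    sumℚ (map F (h x) ++ map F (concatMap h xs))       ≡⟨ sumℚ-++ (map F (h x)) (map F (concatMap h xs)) ⟩
    sumℚ (map F (h x)) + sumℚ (map F (concatMap h xs)) ≡⟨ cong (sumℚ (map F (h x)) +_) (sumℚ-concatMap F h xs) ⟩
    sumℚ (map F (h x)) + sumℚ (map (sumℚ ∘ map F ∘ h) xs) ∎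

  sumℚ-subs-∷ : ∀ (F : Mono → ℚ) e μ →
                sumℚ (map F (subs (e ∷ μ))) ≡ sumℚ (applyUpTo (λ d → sumℚ (map (F ∘ (d ∷_)) (subs μ))) (suc e))
  sumℚ-subs-∷ F e μ = begin
    sumℚ (map F (concatMap (λ d → map (d ∷_) (subs μ)) (upTo (suc e))))
      ≡⟨ sumℚ-concatMap F (λ d → map (d ∷_) (subs μ)) (upTo (suc e)) ⟩
    sumℚ (map (λ d → sumℚ (map F (map (d ∷_) (subs μ)))) (upTo (suc e)))
      ≡⟨ cong sumℚ (List.map-applyUpTo (λ d → d) (λ d → sumℚ (map F (map (d ∷_) (subs μ)))) (suc e)) ⟩
    sumℚ (applyUpTo (λ d → sumℚ (map F (map (d ∷_) (subs μ)))) (suc e))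
      ≡⟨ cong sumℚ (applyUpTo-cong (λ d → cong sumℚ (sym (List.map-∘ {g = F} {f = d ∷_} (subs μ)))) (suc e)) ⟩
    sumℚ (applyUpTo (λ d → sumℚ (map (F ∘ (d ∷_)) (subs μ))) (suc e)) ∎

  sumℚ-subs-pair : ∀ (F : Mono → ℚ) i j →
    sumℚ (map F (subs (i ∷ j ∷ []))) ≡ sumℚ (applyUpTo (λ d → sumℚ (applyUpTo (λ e → F (d ∷ e ∷ [])) (suc j))) (suc i))
  sumℚ-subs-pair F i j = trans (sumℚ-subs-∷ F i (j ∷ [])) (cong sumℚ (applyUpTo-cong inner (suc i)))
    where
    inner : ∀ d → sumℚ (map (F ∘ (d ∷_)) (subs (j ∷ []))) ≡ sumℚ (applyUpTo (λ e → F (d ∷ e ∷ [])) (suc j))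
    inner d = trans (sumℚ-subs-∷ (F ∘ (d ∷_)) j [])
                    (cong sumℚ (applyUpTo-cong (λ e → ℚₚ.+-identityʳ (F (d ∷ e ∷ []))) (suc j)))

  subs-pad : ∀ k μ → subs (pad k μ) ≡ map (pad k) (subs μ)
  subs-pad zero    μ = sym (List.map-id (subs μ))
  subs-pad (suc k) μ = begin
    map (0 ∷_) (subs (pad k μ)) ++ []     ≡⟨ List.++-identityʳ _ ⟩
    map (0 ∷_) (subs (pad k μ))           ≡⟨ cong (map (0 ∷_)) (subs-pad k μ) ⟩
    map (0 ∷_) (map (pad k) (subs μ))     ≡⟨ List.map-∘ {g = 0 ∷_} {f = pad k} (subs μ) ⟨
    map (pad (suc k)) (subs μ)            ∎

  zipWith-pad : ∀ k μ ν → zipWith _∸_ (pad k μ) (pad k ν) ≡ pad k (zipWith _∸_ μ ν)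
  zipWith-pad zero    μ ν = refl
  zipWith-pad (suc k) μ ν = cong (0 ∷_) (zipWith-pad k μ ν)

  allZero-pad : ∀ k μ → allZero (pad k μ) ≡ allZero μ
  allZero-pad zero    μ = refl
  allZero-pad (suc k) μ = allZero-pad k μ

  isUnit-pad : ∀ k μ → isUnit (pad k μ) ≡ isUnit μ
  isUnit-pad zero    μ = refl
  isUnit-pad (suc k) μ = isUnit-pad k μ

  varMul-suc : ∀ l T e ν → varMul (suc l) T (e ∷ ν) ≡ varMul l (T ∘ (e ∷_)) ν
  varMul-suc l T e ν with decAt l ν
  ... | nothing = refl
  ... | just _  = refl

  sum-varMul-pad : ∀ k n (T : ℕ → Series) μ →
    sumℚ (applyUpTo (λ l → varMul l (T l) (pad k μ)) (k ℕ.+ n)) ≡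
    sumℚ (applyUpTo (λ l → varMul l (T (k ℕ.+ l) ∘ pad k) μ) n)
  sum-varMul-pad zero    n T μ = refl
  sum-varMul-pad (suc k) n T μ = begin
    0ℚ + sumℚ (applyUpTo (λ l → varMul (suc l) (T (suc l)) (0 ∷ pad k μ)) (k ℕ.+ n))
      ≡⟨ ℚₚ.+-identityˡ _ ⟩
    sumℚ (applyUpTo (λ l → varMul (suc l) (T (suc l)) (0 ∷ pad k μ)) (k ℕ.+ n))
      ≡⟨ cong sumℚ (applyUpTo-cong (λ l → varMul-suc l (T (suc l)) 0 (pad k μ)) (k ℕ.+ n)) ⟩
    sumℚ (applyUpTo (λ l → varMul l (T (suc l) ∘ (0 ∷_)) (pad k μ)) (k ℕ.+ n))
      ≡⟨ sum-varMul-pad k n (λ l → T (suc l) ∘ (0 ∷_)) μ ⟩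
    sumℚ (applyUpTo (λ l → varMul l (T (suc k ℕ.+ l) ∘ pad (suc k)) μ) n) ∎

module Restriction (z : ℕ) where

  open Bivariate
  open Monomials
  open import Data.Bool using (if_then_else_)
  open import Data.List using (map; upTo; replicate; zipWith; length)
  import Data.List.Properties as List
  open import Data.Rational using (_+_; _*_; _-_)
  open import Data.Rational.Solver using (module +-*-Solver)
  open +-*-Solver using (solve; _:=_; _:+_; _:-_)
  open ≡-Reasoning

  a : ℕ
  a = suc (suc z)

  restrict : Series → ℚ[[x,y]]
  restrict f i j = f (coeffMono a i j)

  restrict-⊛ : ∀ f g → restrict (f ⊛ g) ≋ restrict f ⊗ restrict g
  restrict-⊛ f g i j = begin
    sumℚ (map (λ ν → f ν * g (zipWith _∸_ (pad z μ) ν)) (subs (pad z μ)))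
      ≡⟨ cong (λ l → sumℚ (map (λ ν → f ν * g (zipWith _∸_ (pad z μ) ν)) l)) (subs-pad z μ) ⟩
    sumℚ (map (λ ν → f ν * g (zipWith _∸_ (pad z μ) ν)) (map (pad z) (subs μ)))
      ≡⟨ cong sumℚ (sym (List.map-∘ {g = λ ν → f ν * g (zipWith _∸_ (pad z μ) ν)} {f = pad z} (subs μ))) ⟩
    sumℚ (map (λ ν → f (pad z ν) * g (zipWith _∸_ (pad z μ) (pad z ν))) (subs μ))
      ≡⟨ cong sumℚ (List.map-cong (λ ν → cong (λ κ → f (pad z ν) * g κ) (zipWith-pad z μ ν)) (subs μ)) ⟩
    sumℚ (map (λ ν → f (pad z ν) * g (pad z (zipWith _∸_ μ ν))) (subs μ))
      ≡⟨ sumℚ-subs-pair (λ ν → f (pad z ν) * g (pad z (zipWith _∸_ μ ν))) i j ⟩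
    sumℚ (applyUpTo (λ d → sumℚ (applyUpTo (λ e → restrict f d e * restrict g (i ∸ d) (j ∸ e)) (suc j))) (suc i))
      ≡⟨ ⊗-as-double-sum (restrict f) (restrict g) i j ⟨
    (restrict f ⊗ restrict g) i j ∎
    where μ = i ∷ j ∷ []

  restrict-oneS : restrict oneS ≋ 𝟙
  restrict-oneS i j = trans (cong (λ t → if t then 1ℚ else 0ℚ) (allZero-pad z (i ∷ j ∷ []))) (unpadded i j)
    where
    unpadded : ∀ i j → oneS (i ∷ j ∷ []) ≡ 𝟙 i j
    unpadded zero    zero    = refl
    unpadded zero    (suc j) = refl
    unpadded (suc i) j       = refl

  restrict-S₁ : restrict S₁ ≋ x ⊕ y
  restrict-S₁ i j = trans (cong (λ t → if t then 1ℚ else 0ℚ) (isUnit-pad z (i ∷ j ∷ []))) (unpadded i j)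
    where
    unpadded : ∀ i j → S₁ (i ∷ j ∷ []) ≡ (x ⊕ y) i j
    unpadded zero          zero          = refl
    unpadded zero          (suc zero)    = refl
    unpadded zero          (suc (suc j)) = refl
    unpadded (suc zero)    zero          = refl
    unpadded (suc zero)    (suc j)       = refl
    unpadded (suc (suc i)) zero          = refl
    unpadded (suc (suc i)) (suc j)       = refl

  restrict-^S : ∀ f r → restrict (f ^S r) ≋ restrict f ^ r
  restrict-^S f zero        = restrict-oneS
  restrict-^S f (suc r) i j =
    trans (restrict-⊛ f (f ^S r) i j) (⊗-cong {restrict f} (λ _ _ → refl) (restrict-^S f r) i j)

  sumTerm-restrict : ∀ S i j →
    sumTerm S (coeffMono a i j) ≡ (X* restrict (S ^S a)) i j + (Y* restrict (S ^S suc a)) i j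
  sumTerm-restrict S i j = begin
    sumℚ (map H (upTo (length (pad z μ))))
      ≡⟨ cong (λ n → sumℚ (map H (upTo n)))
              (trans (List.length-++ (replicate z 0)) (cong (ℕ._+ 2) (List.length-replicate z))) ⟩
    sumℚ (map H (upTo (z ℕ.+ 2)))
      ≡⟨ cong sumℚ (List.map-applyUpTo (λ l → l) H (z ℕ.+ 2)) ⟩
    sumℚ (applyUpTo H (z ℕ.+ 2))
      ≡⟨ sum-varMul-pad z 2 (λ l → S ^S (l ℕ.+ 2)) μ ⟩
    varMul 0 (S ^S (z ℕ.+ 0 ℕ.+ 2) ∘ pad z) μ + (varMul 1 (S ^S (z ℕ.+ 1 ℕ.+ 2) ∘ pad z) μ + 0ℚ)
      ≡⟨ cong₂ _+_ (cong (λ k → varMul 0 (S ^S k ∘ pad z) μ) exponentˣ)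
                   (trans (ℚₚ.+-identityʳ _) (cong (λ k → varMul 1 (S ^S k ∘ pad z) μ) exponentʸ)) ⟩
    varMul 0 (S ^S a ∘ pad z) μ + varMul 1 (S ^S suc a ∘ pad z) μ
      ≡⟨ cong₂ _+_ (varMul-x (S ^S a) i j) (varMul-y (S ^S suc a) i j) ⟩
    (X* restrict (S ^S a)) i j + (Y* restrict (S ^S suc a)) i j ∎
    where
    μ = i ∷ j ∷ []
    H = λ l → varMul l (S ^S (l ℕ.+ 2)) (pad z μ)

    exponentˣ : z ℕ.+ 0 ℕ.+ 2 ≡ a
    exponentˣ = trans (ℕ.+-comm (z ℕ.+ 0) 2) (cong (suc ∘ suc) (ℕ.+-identityʳ z))

    exponentʸ : z ℕ.+ 1 ℕ.+ 2 ≡ suc a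
    exponentʸ = trans (ℕ.+-comm (z ℕ.+ 1) 2) (cong (suc ∘ suc) (ℕ.+-comm z 1))

    varMul-x : ∀ f i j → varMul 0 (f ∘ pad z) (i ∷ j ∷ []) ≡ (X* restrict f) i j
    varMul-x f zero    j = refl
    varMul-x f (suc i) j = refl

    varMul-y : ∀ f i j → varMul 1 (f ∘ pad z) (i ∷ j ∷ []) ≡ (Y* restrict f) i j
    varMul-y f i zero    = refl
    varMul-y f i (suc j) = refl

  restrict-root : ∀ S → (∀ μ → 0ℚ ≡ (oneS μ - S μ) + sumTerm S μ) →
                  restrict S ≋ 𝟙 ⊕ (x ⊗ restrict S ^ a ⊕ y ⊗ restrict S ^ suc a)
  restrict-root S root i j = begin
    S μ
      ≡⟨ ℚₚ.+-identityʳ (S μ) ⟨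
    S μ + 0ℚ
      ≡⟨ cong (S μ +_) (root μ) ⟩
    S μ + ((oneS μ - S μ) + sumTerm S μ)
      ≡⟨ solve 3 (λ u s t → s :+ ((u :- s) :+ t) := u :+ t) refl (oneS μ) (S μ) (sumTerm S μ) ⟩
    oneS μ + sumTerm S μ
      ≡⟨ cong₂ _+_ (restrict-oneS i j) (sumTerm-restrict S i j) ⟩
    𝟙 i j + ((X* restrict (S ^S a)) i j + (Y* restrict (S ^S suc a)) i j)
      ≡⟨ cong (𝟙 i j +_) (cong₂ _+_ (X*-cong (restrict-^S S a) i j) (Y.X*-cong (restrict-^S S (suc a) i) j)) ⟩
    𝟙 i j + ((X* (restrict S ^ a)) i j + (Y* (restrict S ^ suc a)) i j)
      ≡⟨ cong (𝟙 i j +_) (cong₂ _+_ (x-⊗ (restrict S ^ a) i j) (y-⊗ (restrict S ^ suc a) i j)) ⟨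
    𝟙 i j + ((x ⊗ restrict S ^ a) i j + (y ⊗ restrict S ^ suc a) i j) ∎
    where μ = coeffMono a i j

  restrict-quotient : ∀ S G → (∀ μ → S μ - oneS μ ≡ (S₁ ⊛ G) μ) →
                      ∀ i j → ((x ⊕ y) ⊗ restrict G) (suc i) j ≡ restrict S (suc i) j
  restrict-quotient S G quotient i j = begin
    ((x ⊕ y) ⊗ restrict G) (suc i) j
      ≡⟨ ⊗-cong restrict-S₁ (λ _ _ → refl) (suc i) j ⟨
    (restrict S₁ ⊗ restrict G) (suc i) j
      ≡⟨ restrict-⊛ S₁ G (suc i) j ⟨
    (S₁ ⊛ G) μ
      ≡⟨ quotient μ ⟨
    S μ - oneS μ
      ≡⟨ cong (S μ -_) (restrict-oneS (suc i) j) ⟩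
    S μ - 0ℚ
      ≡⟨ ℚₚ.+-identityʳ (S μ) ⟩
    S μ ∎
    where μ = coeffMono a (suc i) j

open import Data.Rational using (_+_; _-_)

theorem2p1 : (S G : Series)
    → (∀ μ → allZero μ ≡ true → S μ ≡ 1ℚ)
    → (∀ μ → 0ℚ ≡ (oneS μ - S μ) + sumTerm S μ)
    → (∀ μ → S μ - oneS μ ≡ (S₁ ⊛ G) μ)
    → (a : ℕ) → 2 ≤ a → (ma mb : ℕ)
    → G (coeffMono a ma mb) ≡ geodeFormula a ma mb
theorem2p1 S G _ root quotient (suc (suc z)) (s≤s (s≤s z≤n)) ma mb = begin
  restrict G ma mb                    ≡⟨ x⊕y-⊗-injective same-quotient ma mb ⟩
  geode ma mb                         ≡⟨ geodeFormula≡geode ma mb ⟨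
  geodeFormula (suc (suc z)) ma mb    ∎
  where
  open ≡-Reasoning
  open Bivariate
  open Restriction z using (restrict; restrict-root; restrict-quotient)
  open Lagrange (suc z) using (coeff; root≋coeff₁; geode; x⊕y-⊗-geode; geodeFormula≡geode)

  same-quotient : ∀ i j → ((x ⊕ y) ⊗ restrict G) (suc i) j ≡ ((x ⊕ y) ⊗ geode) (suc i) j
  same-quotient i j = begin
    ((x ⊕ y) ⊗ restrict G) (suc i) j  ≡⟨ restrict-quotient S G quotient i j ⟩
    restrict S (suc i) j              ≡⟨ root≋coeff₁ (restrict S) (restrict-root S root) (suc i) j ⟩
    coeff 1 (suc i) j                 ≡⟨ x⊕y-⊗-geode i j ⟨
    ((x ⊕ y) ⊗ geode) (suc i) j       ∎
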